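{- Let $r\ge2$, $n\ge1$, $\mathbf u=(n,\dots,n)\in\mathbb{N}_{>0}^r$, and let $P$ be a nonidentity $r\times r$ permutation matrix. Define $\tau_P(a,x)=0$ if $a=0$, $\tau_P(a,x)=x$ if $a=\mathbf u$, and $\tau_P(a,x)=Px$ if $a\notin\{0,\mathbf u\}$, for $a,x\in E_{\mathbf u}$. Then $\tau_P$ satisfies (S1), (S2) and (S3) on $E_{\mathbf u}$.
   Context: For $\mathbf u\in\mathbb{N}_{>0}^r$, $E_{\mathbf u}=\{x\in\mathbb{Z}_{\ge0}^r:0\le x\le\mathbf u\}$ is the effect algebra with partial addition $x\oplus y=x+y$ defined (written $x\perp y$) iff $x+y\le\mathbf u$, top $\mathbf u$. Axioms for a total binary operation $\circ$: (S1) $b\perp c\Rightarrow a\circ(b\oplus c)=(a\circ b)\oplus(a\circ c)$; (S2) $\mathbf u\circ a=a$; (S3) $a\circ b=0\Rightarrow a\circ b=b\circ a$. -}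

module Defs where

open import Data.Nat using (ℕ; zero; suc; _+_; _≤_)
open import Data.Nat.Properties using (_≟_)
open import Data.Fin using (Fin)
open import Data.Bool using (Bool; true; false; if_then_else_)
open import Data.Product using (_×_)
open import Function.Bundles using (_↔_; Inverse)
open import Relation.Binary.PropositionalEquality using (_≡_)
open import Relation.Nullary.Decidable using (⌊_⌋)
open import Data.Fin.Properties using (all?)

Vecℕ : ℕ → Set
Vecℕ r = Fin r → ℕ

const : ∀ {r} → ℕ → Vecℕ r
const c _ = c

_≤ᵛ_ : ∀ {r} → Vecℕ r → Vecℕ r → Set
x ≤ᵛ y = ∀ i → x i ≤ y i

_+ᵛ_ : ∀ {r} → Vecℕ r → Vecℕ r → Vecℕ r
(x +ᵛ y) i = x i + y i

_≈ᵛ_ : ∀ {r} → Vecℕ r → Vecℕ r → Set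
x ≈ᵛ y = ∀ i → x i ≡ y i

isConst : ∀ {r} → ℕ → Vecℕ r → Bool
isConst c x = ⌊ all? (λ i → x i ≟ c) ⌋

InE : ∀ {r} → ℕ → Vecℕ r → Set
InE n x = x ≤ᵛ const n

Orth : ∀ {r} → ℕ → Vecℕ r → Vecℕ r → Set
Orth n x y = (x +ᵛ y) ≤ᵛ const n

-- Action of the permutation matrix P of the permutation π:
-- P has entry 1 at (i, π i), so (P x)_i = x_(π i).
permApply : ∀ {r} → (Fin r ↔ Fin r) → Vecℕ r → Vecℕ r
permApply π x i = x (Inverse.to π i)

IsIdPerm : ∀ {r} → (Fin r ↔ Fin r) → Set
IsIdPerm π = ∀ i → Inverse.to π i ≡ i

tau : ∀ {r} → ℕ → (Fin r ↔ Fin r) → Vecℕ r → Vecℕ r → Vecℕ r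
tau n π a x =
  if isConst 0 a then const 0
  else (if isConst n a then x else permApply π x)

S1 : ∀ {r} → ℕ → (Vecℕ r → Vecℕ r → Vecℕ r) → Set
S1 {r} n _∘_ = ∀ (a b c : Vecℕ r) → InE n a → InE n b → InE n c →
  Orth n b c → (a ∘ (b +ᵛ c)) ≈ᵛ ((a ∘ b) +ᵛ (a ∘ c))

S2 : ∀ {r} → ℕ → (Vecℕ r → Vecℕ r → Vecℕ r) → Set
S2 {r} n _∘_ = ∀ (a : Vecℕ r) → InE n a → (const n ∘ a) ≈ᵛ a

S3 : ∀ {r} → ℕ → (Vecℕ r → Vecℕ r → Vecℕ r) → Set
S3 {r} n _∘_ = ∀ (a b : Vecℕ r) → InE n a → InE n b →
  (a ∘ b) ≈ᵛ const 0 → (a ∘ b) ≈ᵛ (b ∘ a)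

Closed : ∀ {r} → ℕ → (Vecℕ r → Vecℕ r → Vecℕ r) → Set
Closed {r} n _∘_ = ∀ (a b : Vecℕ r) → InE n a → InE n b → InE n (a ∘ b)

{-# OPTIONS --safe #-}
-- For fixed a, the map x ↦ τ_P(a, x) is 0, the identity or P, each additive,
-- which gives (S1); as u ≠ 0 (since n ≥ 1), τ_P(u, ·) is the identity (S2).
-- Since P kills no nonzero vector, τ_P has no zero divisors: τ_P(a, b) = 0
-- forces a = 0 or b = 0, and either way τ_P(b, a) = 0, which is (S3).
module Submission where

open import Defs
open import Data.Nat using (ℕ; _≤_; suc; z≤n; s≤s)
open import Data.Nat.Properties using (_≟_)
open import Data.Fin using (Fin)
open import Data.Fin.Properties using (all?)
open import Data.Product using (_×_; _,_)
open import Data.Sum using (_⊎_; inj₁; inj₂)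
open import Function.Base using (id)
open import Function.Bundles using (_↔_; Inverse)
open import Relation.Nullary using (¬_; yes; no; contradiction)
open import Relation.Binary.PropositionalEquality using (_≡_; refl; sym; trans; cong)

module _ {r : ℕ} (π : Fin r ↔ Fin r) where

  open Inverse π using (to; from; strictlyInverseˡ)

  permApply-closed : ∀ {n x} → InE n x → InE n (permApply π x)
  permApply-closed x≤n i = x≤n (to i)

  permApply≈0⇒≈0 : ∀ {x} → permApply π x ≈ᵛ const 0 → x ≈ᵛ const 0
  permApply≈0⇒≈0 {x} Px≈0 j = trans (cong x (sym (strictlyInverseˡ j))) (Px≈0 (from j))

module _ {r : ℕ} (n : ℕ) (π : Fin r ↔ Fin r) where

  data TauCase (a : Vecℕ r) : (Vecℕ r → Vecℕ r) → Set where
    vanishing : a ≈ᵛ const 0 → TauCase a (λ _ → const 0)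
    identity  : ¬ a ≈ᵛ const 0 → a ≈ᵛ const n → TauCase a id
    permuting : ¬ a ≈ᵛ const 0 → ¬ a ≈ᵛ const n → TauCase a (permApply π)

  tauCase : ∀ a → TauCase a (tau n π a)
  tauCase a with all? (λ i → a i ≟ 0)
  ... | yes a≈0 = vanishing a≈0
  ... | no a≉0 with all? (λ i → a i ≟ n)
  ...   | yes a≈n = identity a≉0 a≈n
  ...   | no a≉n = permuting a≉0 a≉n

  tau-closed : Closed n (tau n π)
  tau-closed a x _ x≤n = closed (tauCase a)
    where
    closed : ∀ {f} → TauCase a f → InE n (f x)
    closed (vanishing _)   i = z≤n
    closed (identity _ _)  i = x≤n i
    closed (permuting _ _) i = permApply-closed π x≤n i

  tau-+ᵛ : ∀ a x y → tau n π a (x +ᵛ y) ≈ᵛ (tau n π a x +ᵛ tau n π a y)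
  tau-+ᵛ a x y = additive (tauCase a)
    where
    additive : ∀ {f} → TauCase a f → f (x +ᵛ y) ≈ᵛ (f x +ᵛ f y)
    additive (vanishing _)   i = refl
    additive (identity _ _)  i = refl
    additive (permuting _ _) i = refl

  tau-zeroˡ : ∀ {a} x → a ≈ᵛ const 0 → tau n π a x ≈ᵛ const 0
  tau-zeroˡ {a} x a≈0 = vanishes (tauCase a)
    where
    vanishes : ∀ {f} → TauCase a f → f x ≈ᵛ const 0
    vanishes (vanishing _)      i = refl
    vanishes (identity a≉0 _)  i = contradiction a≈0 a≉0
    vanishes (permuting a≉0 _) i = contradiction a≈0 a≉0

  tau-zeroʳ : ∀ a {x} → x ≈ᵛ const 0 → tau n π a x ≈ᵛ const 0
  tau-zeroʳ a {x} x≈0 = vanishes (tauCase a)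
    where
    vanishes : ∀ {f} → TauCase a f → f x ≈ᵛ const 0
    vanishes (vanishing _)   i = refl
    vanishes (identity _ _)  i = x≈0 i
    vanishes (permuting _ _) i = x≈0 (Inverse.to π i)

  tau≈0⇒a≈0⊎x≈0 : ∀ a x → tau n π a x ≈ᵛ const 0 → a ≈ᵛ const 0 ⊎ x ≈ᵛ const 0
  tau≈0⇒a≈0⊎x≈0 a x = zero-factor (tauCase a)
    where
    zero-factor : ∀ {f} → TauCase a f → f x ≈ᵛ const 0 → a ≈ᵛ const 0 ⊎ x ≈ᵛ const 0
    zero-factor (vanishing a≈0) _    = inj₁ a≈0
    zero-factor (identity _ _)  x≈0  = inj₂ x≈0
    zero-factor (permuting _ _) Px≈0 = inj₂ (permApply≈0⇒≈0 π Px≈0)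

  tau-S1 : S1 n (tau n π)
  tau-S1 a b c _ _ _ _ = tau-+ᵛ a b c

  tau-S3 : S3 n (tau n π)
  tau-S3 a b _ _ ab≈0 i with tau≈0⇒a≈0⊎x≈0 a b ab≈0
  ... | inj₁ a≈0 = trans (ab≈0 i) (sym (tau-zeroʳ b a≈0 i))
  ... | inj₂ b≈0 = trans (ab≈0 i) (sym (tau-zeroˡ a b≈0 i))

tau-S2 : ∀ {r} m (π : Fin r ↔ Fin r) → S2 (suc m) (tau (suc m) π)
tau-S2 m π a _ i = top (tauCase (suc m) π (const (suc m)))
  where
  top : ∀ {f} → TauCase (suc m) π (const (suc m)) f → f a i ≡ a i
  top (vanishing u≈0)   = contradiction (u≈0 i) λ ()
  top (identity _ _)    = refl
  top (permuting _ u≉u) = contradiction (λ _ → refl) u≉u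

corollary5p8 : (r n : ℕ) → 2 ≤ r → 1 ≤ n → (π : Fin r ↔ Fin r) → ¬ IsIdPerm π →
    Closed n (tau n π) × S1 n (tau n π) × S2 n (tau n π) × S3 n (tau n π)
corollary5p8 r (suc m) _ (s≤s _) π _ =
  tau-closed (suc m) π , tau-S1 (suc m) π , tau-S2 m π , tau-S3 (suc m) π
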